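{- Let $\mathcal{T}_p$ be the set of plane binary trees with $p$ internal nodes, $V = \bigcup_{p \geq 0}\mathcal{T}_p$, and $\mathbb{C}(q)[V]$ the $\mathbb{C}(q)$-vector space with basis $V$. Define linear operators by $U(T) = \sum_{i=0}^{p} q^{i}\, \mathrm{SG}(T,i)$ for $T \in \mathcal{T}_p$, and $D(T) = T^*$ for $T \neq \emptyset$, $D(\emptyset) = 0$. Then $DU - qUD = I$.
   Context: A plane binary tree is a tree embedded in the plane with a unique root node having exactly one child, internal nodes each having exactly two (left and right) children, and leaves having no children; if there are $n$ internal nodes, the leaves are numbered $0,1,\dots,n$ from left to right. $\mathcal{T}_0 = \{\emptyset\}$ where $\emptyset$ has a root, no internal nodes and a single leaf. Grafting: for $T_1 \in \mathcal{T}_a$, $T_2 \in \mathcal{T}_b$, $T_1 \vee T_2 \in \mathcal{T}_{a+b+1}$ is formed by placing $T_1$ left of $T_2$, identifying their root nodes into a new internal node (with left subtree from $T_1$, right subtree from $T_2$), and attaching a new root above it. Splicing: for $T \in \mathcal{T}_p$ and $i \in \{0,\dots,p\}$, let $P$ be the path from leaf $i$ to the root; the edges of $T$ weakly left of $P$ form a tree $T_1 \in \mathcal{T}_i$ and the edges weakly right of $P$ form $T_2 \in \mathcal{T}_{p-i}$ (each internal node of $T$ goes to exactly one of them). Set $\mathrm{SG}(T,i) = T_1 \vee T_2 \in \mathcal{T}_{p+1}$. For $T \in \mathcal{T}_p$, $p \geq 1$, $T^* \in \mathcal{T}_{p-1}$ is obtained by removing the leftmost leaf (leaf $0$) and erasing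 the internal node to which it is attached (its other child is joined to that node's parent). Equivalently, $(\mathrm{Tree},\mathrm{Tree}')$ is a pair of quantized dual graded graphs with differential coefficient $1$. -}

module Defs where

open import Level using (_⊔_)
open import Data.Nat using (ℕ; zero; suc; _≤ᵇ_; _∸_) renaming (_+_ to _+ℕ_)
open import Data.Bool using (Bool; true; false; if_then_else_)
open import Data.List using (List; []; _∷_; map; concatMap; upTo; foldr)
open import Data.Product using (_×_; _,_; proj₁; proj₂)
open import Relation.Nullary using (Dec; yes; no)
open import Relation.Binary.PropositionalEquality using (_≡_; refl; cong₂)
open import Algebra.Bundles using (CommutativeRing)

-- Plane binary trees.  The unique root node (with one child) is implicit:
-- 'leaf' is the tree ∅ ∈ 𝒯₀, and 'node L R' is L ∨ R (grafting).
data Tree : Set where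
  leaf : Tree
  node : Tree → Tree → Tree

size : Tree → ℕ
size leaf = 0
size (node L R) = suc (size L +ℕ size R)

_∨_ : Tree → Tree → Tree
T₁ ∨ T₂ = node T₁ T₂

-- Splitting along the path P from leaf i to the root:
-- split T i = (T₁ , T₂) with T₁ the edges weakly left of P,
-- T₂ the edges weakly right of P.
-- If leaf i lies in the left subtree L (i ≤ size L), the internal node at the
-- top goes to the right part; otherwise it goes to the left part.
split : Tree → ℕ → Tree × Tree
split leaf i = leaf , leaf
split (node L R) i with i ≤ᵇ size L
... | true  = proj₁ (split L i) , node (proj₂ (split L i)) R
... | false = node L (proj₁ (split R (i ∸ suc (size L)))) , proj₂ (split R (i ∸ suc (size L)))

SG : Tree → ℕ → Tree
SG T i = proj₁ (split T i) ∨ proj₂ (split T i)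

-- T* : remove leaf 0 and erase the internal node it is attached to (T ≠ ∅)
star : Tree → Tree
star leaf = leaf   -- never used: D(∅) = 0
star (node leaf R) = R
star (node (node L₁ L₂) R) = node (star (node L₁ L₂)) R

_≟T_ : (S T : Tree) → Dec (S ≡ T)
leaf ≟T leaf = yes refl
leaf ≟T node _ _ = no (λ ())
node _ _ ≟T leaf = no (λ ())
node L R ≟T node L' R' with L ≟T L' | R ≟T R'
... | yes refl | yes refl = yes refl
... | no ne | _ = no (λ { refl → ne refl })
... | yes _ | no ne = no (λ { refl → ne refl })

-- Vectors of the free module R[V] with basis V = all trees, represented as
-- finite formal linear combinations; two vectors are equal iff all their
-- coefficients agree (in the ring's setoid equality).
module FreeModule {c ℓ} (R : CommutativeRing c ℓ) where
  open CommutativeRing R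

  Vect : Set c
  Vect = List (Carrier × Tree)

  coeff : Vect → Tree → Carrier
  coeff [] T = 0#
  coeff ((a , S) ∷ v) T with S ≟T T
  ... | yes _ = a + coeff v T
  ... | no _  = coeff v T

  linExt : (Tree → Vect) → Vect → Vect
  linExt f v = concatMap (λ aS → map (λ bT → (proj₁ aS * proj₁ bT , proj₂ bT)) (f (proj₂ aS))) v

  pow : Carrier → ℕ → Carrier
  pow x zero = 1#
  pow x (suc n) = x * pow x n

  Ubasis : Carrier → Tree → Vect
  Ubasis q T = map (λ i → (pow q i , SG T i)) (upTo (suc (size T)))

  Dbasis : Tree → Vect
  Dbasis leaf = []
  Dbasis T@(node _ _) = (1# , star T) ∷ []

  U : Carrier → Vect → Vect
  U q = linExt (Ubasis q)

  D : Vect → Vect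
  D = linExt Dbasis

-- Deleting leaf 0 commutes with splicing, shifted by one: leaf 0 always lies in the left
-- part T₁, so SG(T,0)* = T and SG(T,i+1)* = SG(T*,i) for T ≠ ∅.  Hence D U T = T + q U D T
-- for every tree T (for ∅: U∅ = ∅ ∨ ∅, whose star is ∅, while D∅ = 0), and D U − q U D = I
-- follows by linearity.  Linearity is handled dually: a vector v is paired with coefficient
-- functionals h : Tree → R, D and U act on functionals by their transposes Dᵗ and Uᵗ, and the
-- coefficient of T is the pairing with δ T.

module Submission where

open import Algebra.Bundles using (CommutativeRing)
open import Data.Bool using (true; false)
open import Data.Empty using (⊥-elim)
open import Data.List using ([]; _∷_; map; _++_; upTo)
open import Data.List.Properties using (map-∘; map-upTo)
open import Data.Maybe using (nothing)
open import Data.Nat using (ℕ; zero; suc; _≤ᵇ_) renaming (_+_ to _+ℕ_)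
open import Data.Product using (_×_; _,_; proj₁; proj₂; map₁; uncurry)
open import Function using (_∘_)
open import Relation.Binary.PropositionalEquality as ≡ using (_≡_; _≢_)
open import Relation.Nullary using (yes; no)
open import Tactic.RingSolver.Core.AlmostCommutativeRing using (fromCommutativeRing)

open import Defs

suc-≤ᵇ-suc : ∀ m n → (suc m ≤ᵇ suc n) ≡ (m ≤ᵇ n)
suc-≤ᵇ-suc zero    n = ≡.refl
suc-≤ᵇ-suc (suc m) n = ≡.refl

size-star : ∀ L R → size (star (node L R)) ≡ size L +ℕ size R
size-star leaf         R = ≡.refl
size-star (node L₁ L₂) R = ≡.cong (λ n → suc (n +ℕ size R)) (size-star L₁ L₂)

split-zero : ∀ T → split T 0 ≡ (leaf , T)
split-zero leaf       = ≡.refl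
split-zero (node L R) rewrite split-zero L = ≡.refl

split-suc-star : ∀ L R j → map₁ star (split (node L R) (suc j)) ≡ split (star (node L R)) j
split-suc-star leaf         R j = ≡.refl
split-suc-star (node L₁ L₂) R j
  rewrite suc-≤ᵇ-suc j (size L₁ +ℕ size L₂) | size-star L₁ L₂
  with j ≤ᵇ size L₁ +ℕ size L₂
... | true  = ≡.cong (λ (A , B) → A , node B R) (split-suc-star L₁ L₂ j)
... | false rewrite size-star L₁ L₂ = ≡.refl

split-suc-left≢leaf : ∀ L R j → proj₁ (split (node L R) (suc j)) ≢ leaf
split-suc-left≢leaf leaf         R j ()
split-suc-left≢leaf (node L₁ L₂) R j with suc j ≤ᵇ size (node L₁ L₂)
... | true  = split-suc-left≢leaf L₁ L₂ j
... | false = λ ()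

star-∨ : ∀ {A} B → A ≢ leaf → star (A ∨ B) ≡ star A ∨ B
star-∨ {leaf}     B A≢leaf = ⊥-elim (A≢leaf ≡.refl)
star-∨ {node _ _} B _      = ≡.refl

star-SG-zero : ∀ T → star (SG T 0) ≡ T
star-SG-zero T = ≡.cong (star ∘ uncurry _∨_) (split-zero T)

star-SG-suc : ∀ L R j → star (SG (node L R) (suc j)) ≡ SG (star (node L R)) j
star-SG-suc L R j =
  ≡.trans (star-∨ _ (split-suc-left≢leaf L R j)) (≡.cong (uncurry _∨_) (split-suc-star L R j))

module FreeModuleProperties {c ℓ} (R : CommutativeRing c ℓ) where
  open CommutativeRing R
  open FreeModule R
  open import Relation.Binary.Reasoning.Setoid setoid
  open import Tactic.RingSolver.NonReflective (fromCommutativeRing R (λ _ → nothing))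
    using (solve; _⊜_; _⊕_; _⊗_)

  infix 4 ⟨_∣_⟩

  ⟨_∣_⟩ : Vect → (Tree → Carrier) → Carrier
  ⟨ []          ∣ h ⟩ = 0#
  ⟨ (a , S) ∷ v ∣ h ⟩ = a * h S + ⟨ v ∣ h ⟩

  _·_ : Carrier → Carrier × Tree → Carrier × Tree
  a · (b , S) = a * b , S

  δ : Tree → Tree → Carrier
  δ T S with S ≟T T
  ... | yes _ = 1#
  ... | no  _ = 0#

  ⟨⟩-cong : ∀ v {g h} → (∀ S → g S ≈ h S) → ⟨ v ∣ g ⟩ ≈ ⟨ v ∣ h ⟩
  ⟨⟩-cong []      g≈h = refl
  ⟨⟩-cong (x ∷ v) g≈h = +-cong (*-congˡ (g≈h (proj₂ x))) (⟨⟩-cong v g≈h)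

  ⟨⟩-++ : ∀ u v h → ⟨ u ++ v ∣ h ⟩ ≈ ⟨ u ∣ h ⟩ + ⟨ v ∣ h ⟩
  ⟨⟩-++ []      v h = sym (+-identityˡ _)
  ⟨⟩-++ (x ∷ u) v h = trans (+-congˡ (⟨⟩-++ u v h)) (sym (+-assoc _ _ _))

  ⟨⟩-· : ∀ a v h → ⟨ map (a ·_) v ∣ h ⟩ ≈ a * ⟨ v ∣ h ⟩
  ⟨⟩-· a []      h = sym (zeroʳ a)
  ⟨⟩-· a (x ∷ v) h = trans (+-cong (*-assoc _ _ _) (⟨⟩-· a v h)) (sym (distribˡ a _ _))

  ⟨⟩-linExt : ∀ f v h → ⟨ linExt f v ∣ h ⟩ ≈ ⟨ v ∣ (λ S → ⟨ f S ∣ h ⟩) ⟩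
  ⟨⟩-linExt f []            h = refl
  ⟨⟩-linExt f ((a , S) ∷ v) h = begin
    ⟨ map (a ·_) (f S) ++ linExt f v ∣ h ⟩        ≈⟨ ⟨⟩-++ (map (a ·_) (f S)) (linExt f v) h ⟩
    ⟨ map (a ·_) (f S) ∣ h ⟩ + ⟨ linExt f v ∣ h ⟩ ≈⟨ +-cong (⟨⟩-· a (f S) h) (⟨⟩-linExt f v h) ⟩
    a * ⟨ f S ∣ h ⟩ + ⟨ v ∣ (λ S → ⟨ f S ∣ h ⟩) ⟩ ∎

  ⟨⟩-linear : ∀ v a g h → ⟨ v ∣ (λ S → g S + a * h S) ⟩ ≈ ⟨ v ∣ g ⟩ + a * ⟨ v ∣ h ⟩
  ⟨⟩-linear []            a g h = sym (trans (+-congˡ (zeroʳ a)) (+-identityʳ 0#))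
  ⟨⟩-linear ((b , S) ∷ v) a g h = trans (+-congˡ (⟨⟩-linear v a g h)) (distribute b (g S) a (h S) _ _)
    where
    distribute : ∀ b x a y X Y → b * (x + a * y) + (X + a * Y) ≈ (b * x + X) + a * (b * y + Y)
    distribute = solve 6 (λ b x a y X Y →
      (b ⊗ (x ⊕ a ⊗ y) ⊕ (X ⊕ a ⊗ Y)) ⊜ ((b ⊗ x ⊕ X) ⊕ a ⊗ (b ⊗ y ⊕ Y))) refl

  coeff≈⟨δ⟩ : ∀ v T → coeff v T ≈ ⟨ v ∣ δ T ⟩
  coeff≈⟨δ⟩ []            T = refl
  coeff≈⟨δ⟩ ((a , S) ∷ v) T with S ≟T T
  ... | yes _ = +-cong (sym (*-identityʳ a)) (coeff≈⟨δ⟩ v T)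
  ... | no  _ = trans (coeff≈⟨δ⟩ v T) (sym (trans (+-congʳ (zeroʳ a)) (+-identityˡ _)))

  coeff-linExt∘linExt : ∀ f g v T →
    coeff (linExt f (linExt g v)) T ≈ ⟨ v ∣ (λ S → ⟨ g S ∣ (λ S′ → ⟨ f S′ ∣ δ T ⟩) ⟩) ⟩
  coeff-linExt∘linExt f g v T =
    trans (coeff≈⟨δ⟩ (linExt f (linExt g v)) T) (trans (⟨⟩-linExt f (linExt g v) (δ T)) (⟨⟩-linExt g v _))

  ⟨⟩-map-cong : ∀ (a : ℕ → Carrier) (X Y : ℕ → Tree) xs {g h} → (∀ i → g (X i) ≈ h (Y i)) →
                ⟨ map (λ i → a i , X i) xs ∣ g ⟩ ≈ ⟨ map (λ i → a i , Y i) xs ∣ h ⟩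
  ⟨⟩-map-cong a X Y []       gX≈hY = refl
  ⟨⟩-map-cong a X Y (i ∷ xs) gX≈hY = +-cong (*-congˡ (gX≈hY i)) (⟨⟩-map-cong a X Y xs gX≈hY)

  Dᵗ : (Tree → Carrier) → Tree → Carrier
  Dᵗ h S = ⟨ Dbasis S ∣ h ⟩

  Uᵗ : Carrier → (Tree → Carrier) → Tree → Carrier
  Uᵗ q h S = ⟨ Ubasis q S ∣ h ⟩

  Dᵗ-∨ : ∀ h A B → Dᵗ h (A ∨ B) ≈ h (star (A ∨ B))
  Dᵗ-∨ h A B = trans (+-identityʳ _) (*-identityˡ _)

  Dᵗ-SG : ∀ h T i → Dᵗ h (SG T i) ≈ h (star (SG T i))
  Dᵗ-SG h T i = Dᵗ-∨ h (proj₁ (split T i)) (proj₂ (split T i))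

  Ubasis-unfold : ∀ q T →
    Ubasis q T ≡ (1# , SG T 0) ∷ map (q ·_) (map (λ i → pow q i , SG T (suc i)) (upTo (size T)))
  Ubasis-unfold q T = ≡.cong ((1# , SG T 0) ∷_) (≡.trans
    (≡.cong (map F) (≡.sym (map-upTo suc (size T))))
    (≡.trans (≡.sym (map-∘ (upTo (size T)))) (map-∘ (upTo (size T)))))
    where
    F : ℕ → Carrier × Tree
    F i = pow q i , SG T i

  Uᵗ-Dᵗ : ∀ q h S → Uᵗ q (Dᵗ h) S ≈ h S + q * Dᵗ (Uᵗ q h) S
  Uᵗ-Dᵗ q h leaf = begin
    1# * Dᵗ h (leaf ∨ leaf) + 0# ≈⟨ trans (+-identityʳ _) (*-identityˡ _) ⟩
    Dᵗ h (leaf ∨ leaf)           ≈⟨ Dᵗ-∨ h leaf leaf ⟩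
    h leaf                       ≈⟨ sym (trans (+-congˡ (zeroʳ q)) (+-identityʳ _)) ⟩
    h leaf + q * 0#              ∎
  Uᵗ-Dᵗ q h S@(node L R) = begin
    Uᵗ q (Dᵗ h) S
      ≡⟨ ≡.cong (⟨_∣ Dᵗ h ⟩) (Ubasis-unfold q S) ⟩
    1# * Dᵗ h (SG S 0) + ⟨ map (q ·_) (map (λ i → pow q i , SG S (suc i)) (upTo (size S))) ∣ Dᵗ h ⟩
      ≈⟨ +-cong (*-identityˡ _) (⟨⟩-· q (map (λ i → pow q i , SG S (suc i)) (upTo (size S))) (Dᵗ h)) ⟩
    Dᵗ h (SG S 0) + q * ⟨ map (λ i → pow q i , SG S (suc i)) (upTo (size S)) ∣ Dᵗ h ⟩
      ≈⟨ +-cong (trans (Dᵗ-SG h S 0) (reflexive (≡.cong h (star-SG-zero S))))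
                (*-congˡ (⟨⟩-map-cong (pow q) _ _ (upTo (size S)) λ i →
                  trans (Dᵗ-SG h S (suc i)) (reflexive (≡.cong h (star-SG-suc L R i))))) ⟩
    h S + q * ⟨ map (λ i → pow q i , SG (star S) i) (upTo (size S)) ∣ h ⟩
      ≡⟨ ≡.cong (λ n → h S + q * ⟨ map (λ i → pow q i , SG (star S) i) (upTo (suc n)) ∣ h ⟩)
                (≡.sym (size-star L R)) ⟩
    h S + q * Uᵗ q h (star S)
      ≈⟨ +-congˡ (*-congˡ (sym (Dᵗ-∨ (Uᵗ q h) L R))) ⟩
    h S + q * Dᵗ (Uᵗ q h) S ∎

proposition8 : ∀ {c ℓ} (R : CommutativeRing c ℓ) (q : CommutativeRing.Carrier R) (v : FreeModule.Vect R) (T : Tree) → CommutativeRing._≈_ R (CommutativeRing._-_ R (FreeModule.coeff R (FreeModule.D R (FreeModule.U R q v)) T) (CommutativeRing._*_ R q (FreeModule.coeff R (FreeModule.U R q (FreeModule.D R v)) T))) (FreeModule.coeff R v T)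
proposition8 R q v T = begin
  coeff (D (U q v)) T - q * coeff (U q (D v)) T
    ≈⟨ +-cong (coeff-linExt∘linExt Dbasis (Ubasis q) v T)
              (-‿cong (*-congˡ (coeff-linExt∘linExt (Ubasis q) Dbasis v T))) ⟩
  ⟨ v ∣ Uᵗ q (Dᵗ (δ T)) ⟩ - q * ⟨ v ∣ Dᵗ (Uᵗ q (δ T)) ⟩
    ≈⟨ +-congʳ (trans (⟨⟩-cong v (Uᵗ-Dᵗ q (δ T))) (⟨⟩-linear v q (δ T) (Dᵗ (Uᵗ q (δ T))))) ⟩
  (⟨ v ∣ δ T ⟩ + q * ⟨ v ∣ Dᵗ (Uᵗ q (δ T)) ⟩) - q * ⟨ v ∣ Dᵗ (Uᵗ q (δ T)) ⟩
    ≈⟨ //-rightDividesʳ (q * ⟨ v ∣ Dᵗ (Uᵗ q (δ T)) ⟩) ⟨ v ∣ δ T ⟩ ⟩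
  ⟨ v ∣ δ T ⟩
    ≈⟨ sym (coeff≈⟨δ⟩ v T) ⟩
  coeff v T ∎
  where
  open CommutativeRing R
  open FreeModule R
  open FreeModuleProperties R
  open import Relation.Binary.Reasoning.Setoid setoid
  open import Algebra.Properties.Group +-group using (//-rightDividesʳ)
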